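{- Let $U=(E,\mathcal{D},\rho)$ be a U-matroid with set of bases $\mathcal{B}(U)$. Then for every $A\in\mathcal{D}$, \[\rho(A)=\max\{|A\cap B| : B\in\mathcal{B}(U)\}.\]
   Context: $E$ is a finite set. A U-matroid is a triple $(E,\mathcal{D},\rho)$ where $\mathcal{D}\subseteq2^E$ contains $\emptyset,E$, is closed under union and intersection, and is accessible (every nonempty $A\in\mathcal{D}$ contains some $x$ with $A\setminus\{x\}\in\mathcal{D}$), and $\rho:\mathcal{D}\to\mathbb{N}$ satisfies $\rho(\emptyset)=0$, monotonicity, submodularity ($\rho(A)+\rho(B)\ge\rho(A\cup B)+\rho(A\cap B)$), and unit increase ($\rho(A\cup\{e\})-\rho(A)\le 1$ whenever $A,A\cup\{e\}\in\mathcal{D}$). Its base polyhedron is $\{\mathbf{x}\in\mathbb{R}^E:\sum_{a\in A}x_a\le\rho(A)\ \forall A\in\mathcal{D},\ \sum_{e\in E}x_e=\rho(E)\}$; its vertices are $0/1$ vectors, and a basis of $U$ is the support of a vertex of the base polyhedron.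
   Formalization: The base polyhedron, and with it its vertices and the bases of U, is taken over ℚ^E instead of ℝ^E. -}

module Defs where

open import Data.Nat using (ℕ; zero; suc)
import Data.Nat as ℕ
open import Data.Integer using (+_)
open import Data.Fin using (Fin)
open import Data.Fin.Subset using (Subset; _∈_; _⊆_; _∪_; _∩_; _-_; ⁅_⁆; ∣_∣; Nonempty; ⊥; ⊤)
open import Data.Bool using (if_then_else_)
open import Data.Vec using (lookup)
open import Data.Rational using (ℚ; 0ℚ; 1ℚ; _+_; _*_; _≤_; _<_; _/_) renaming (_-_ to _-ℚ_)
open import Data.Product using (Σ; ∃; _×_; _,_)
open import Relation.Binary.PropositionalEquality using (_≡_; _≢_)

-- The ground set E is Fin n; subsets of E are Subset n.
-- D is a predicate on subsets (the lattice 𝒟), ρ a rank function;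
-- only the values of ρ on members of D are ever used.
record IsUMatroid (n : ℕ) (D : Subset n → Set) (ρ : Subset n → ℕ) : Set where
  field
    D-empty : D ⊥
    D-full  : D ⊤
    D-∪     : ∀ A B → D A → D B → D (A ∪ B)
    D-∩     : ∀ A B → D A → D B → D (A ∩ B)
    D-accessible : ∀ A → D A → Nonempty A → Σ (Fin n) (λ x → x ∈ A × D (A - x))
    ρ-empty : ρ ⊥ ≡ 0
    ρ-mono  : ∀ A B → D A → D B → A ⊆ B → ρ A ℕ.≤ ρ B
    ρ-submod : ∀ A B → D A → D B → ρ (A ∪ B) ℕ.+ ρ (A ∩ B) ℕ.≤ ρ A ℕ.+ ρ B
    ρ-unit  : ∀ A e → D A → D (A ∪ ⁅ e ⁆) → ρ (A ∪ ⁅ e ⁆) ℕ.≤ suc (ρ A)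

ℕ→ℚ : ℕ → ℚ
ℕ→ℚ k = + k / 1

sumFin : (n : ℕ) → (Fin n → ℚ) → ℚ
sumFin zero    f = 0ℚ
sumFin (suc n) f = f Fin.zero + sumFin n (λ i → f (Fin.suc i))
  where import Data.Fin as Fin

sumOver : {n : ℕ} → Subset n → (Fin n → ℚ) → ℚ
sumOver {n} A x = sumFin n (λ i → if lookup A i then x i else 0ℚ)

InBasePolyhedron : (n : ℕ) (D : Subset n → Set) (ρ : Subset n → ℕ) → (Fin n → ℚ) → Set
InBasePolyhedron n D ρ x =
  (∀ A → D A → sumOver A x ≤ ℕ→ℚ (ρ A)) × (sumOver ⊤ x ≡ ℕ→ℚ (ρ ⊤))

IsVertex : (n : ℕ) (D : Subset n → Set) (ρ : Subset n → ℕ) → (Fin n → ℚ) → Set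
IsVertex n D ρ x =
  InBasePolyhedron n D ρ x ×
  (∀ (y z : Fin n → ℚ) (t : ℚ) →
     InBasePolyhedron n D ρ y → InBasePolyhedron n D ρ z →
     0ℚ < t → t < 1ℚ →
     (∀ e → x e ≡ t * y e + (1ℚ -ℚ t) * z e) →
     ∀ e → y e ≡ z e)

IsSupport : {n : ℕ} → (Fin n → ℚ) → Subset n → Set
IsSupport x B = ∀ e → (e ∈ B → x e ≢ 0ℚ) × (x e ≢ 0ℚ → e ∈ B)

IsBasis : (n : ℕ) (D : Subset n → Set) (ρ : Subset n → ℕ) → Subset n → Set
IsBasis n D ρ B = ∃ λ x → IsVertex n D ρ x × IsSupport x B

{-# OPTIONS --safe #-}
-- Every A ∈ 𝒟 lies on a maximal chain ∅ = S₀ ⊂ S₁ ⊂ ⋯ ⊂ Sₘ = E of 𝒟 whose steps add one element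
-- each: accessibility gives such a chain up to A, and the sets A ∪ Tᵢ along a maximal chain (Tᵢ)
-- of E continue it. The greedy set B of elements at which ρ increases along the chain satisfies
-- |T ∩ B| ≤ ρ(T) for T ∈ 𝒟 by submodularity, with equality on the chain. So the indicator vector
-- of B lies in the base polyhedron, and it is a vertex since the sums over the chain sets determine
-- every coordinate; this gives |A ∩ B| = ρ(A).
--
-- Conversely every vertex x is a 0/1 vector, whence |A ∩ supp x| = x(A) ≤ ρ(A). The sets tight at x
-- are closed under ∪ and ∩. For a coordinate e take a minimal tight T ∋ e and a maximal tight U ⊆ T
-- avoiding e. If T = U ∪ {e}, then x_e = ρ(T) − ρ(U) ∈ {0, 1} by unit increase. Otherwise some
-- f ∈ T ∖ (U ∪ {e}) lies in exactly the same tight sets as e, so x ± ε(χ_e − χ_f) both stay in the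
-- polyhedron for small ε > 0, which contradicts x being a vertex. Membership in 𝒟 need not be decidable,
-- so T and U only exist under double negation; this suffices because x_e ∈ {0, 1} is decidable.
module Submission where

open import Defs
open import Data.Nat using (ℕ; _≤_)
open import Data.Fin.Subset using (Subset; _∩_; ∣_∣)
open import Data.Product using (Σ; _×_)
open import Relation.Binary.PropositionalEquality using (_≡_)

open import Level using (0ℓ)
open import Function using (case_of_; _∘_; id)
open import Data.Bool using (true; false; if_then_else_; _∧_; _∨_)
open import Data.Bool.Properties using (∧-zeroʳ; ∨-identityʳ)
import Data.Nat as ℕ
import Data.Nat.Properties as ℕ
open import Data.Nat.Coprimality using (1-coprimeTo) renaming (sym to coprime-sym)
import Data.Integer as ℤ
import Data.Integer.Properties as ℤ
open import Data.Rational using (ℚ; mkℚ; 0ℚ; 1ℚ; ½; _+_; _*_; _-_; -_; _⊓_; *≤*)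
import Data.Rational as ℚ
import Data.Rational.Properties as ℚ
open import Algebra.Bundles using (CommutativeMonoid)
open import Algebra.Properties.CommutativeSemigroup
  (CommutativeMonoid.commutativeSemigroup ℚ.+-0-commutativeMonoid) using (interchange)
open import Algebra.Properties.Group ℚ.+-0-group using (∙-cancelˡ)
import Tactic.RingSolver.Core.AlmostCommutativeRing as ACR
open import Tactic.RingSolver using (solve-∀)
open import Data.Fin using (Fin; zero; suc)
import Data.Fin as Fin
import Data.Fin.Subset as Subset
open import Data.Fin.Subset using (_∪_; ⁅_⁆; ⊥; ⊤; _∈_; _∉_; _⊆_; _⊂_; _⊃_; inside; outside)
open import Data.Fin.Subset.Induction using (⊂-wellFounded; ⊃-wellFounded)
open import Data.Fin.Subset.Properties
  using ( _∈?_; _⊂?_; nonempty?; Empty-unique; ∈⊤; ∉⊥; ⊥⊆; ⊆-antisym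
        ; x∈⁅x⁆; x∈⁅y⁆⇒x≡y; x≢y⇒x∉⁅y⁆; p⊆p∪q; q⊆p∪q; p∩q⊆p; p∩q⊆q
        ; x∈p∪q⁻; x∈p∩q⁺; x∈p∩q⁻; x∈p⇒p-x⊂p
        ; ∩-comm; ∩-zeroʳ; ∩-identityʳ; ∩-distribˡ-∪; ∪-assoc; ∪-zeroʳ; ∪-identityʳ; p─⊥≡p
        ; ∣⊥∣≡0; ∣⁅x⁆∣≡1; ∣p∩q∣≤∣q∣)
open import Data.Vec using ([]; _∷_; lookup; here; there)
open import Data.Vec.Properties using (lookup-zipWith; []=⇒lookup; lookup⇒[]=)
open import Data.Maybe using (just; nothing)
open import Data.Product using (∃; _,_; proj₁; proj₂)
import Data.Sum as Sum
open import Data.Sum using (_⊎_; inj₁; inj₂; [_,_]′)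
open import Relation.Nullary using (¬_; yes; no; contradiction)
open import Relation.Nullary.Decidable using (decidable-stable; from-yes; _⊎-dec_)
open import Relation.Binary.Core using (Rel)
open import Relation.Binary.PropositionalEquality
  using (_≢_; refl; sym; trans; cong; cong₂; subst; module ≡-Reasoning)
open import Induction.WellFounded using (WellFounded; Acc; acc)

private variable n : ℕ

¬¬-∃-minimal : ∀ {a p r} {A : Set a} {_<_ : Rel A r} (P : A → Set p) → WellFounded _<_ →
               ∀ {x} → P x → ¬ ¬ (∃ λ m → P m × ∀ {y} → P y → ¬ (y < m))
¬¬-∃-minimal {_<_ = _<_} P wf {x} Px = go (wf x) Px
  where
  go : ∀ {x} → Acc _<_ x → P x → ¬ ¬ (∃ λ m → P m × ∀ {y} → P y → ¬ (y < m))
  go {x} (acc rs) Px no-minimal = no-minimal (x , Px , λ Py y<x → go (rs y<x) Py no-minimal)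

-- Rational arithmetic

ℚ-ring : ACR.AlmostCommutativeRing 0ℓ 0ℓ
ℚ-ring = ACR.fromCommutativeRing ℚ.+-*-commutativeRing λ p → case p ℚ.≟ 0ℚ of λ
  { (yes p≡0) → just (sym p≡0)
  ; (no _)    → nothing
  }

ℕ→ℚ≡mkℚ : ∀ k → ℕ→ℚ k ≡ mkℚ (ℤ.+ k) 0 (coprime-sym (1-coprimeTo k))
ℕ→ℚ≡mkℚ k = ℚ.normalize-coprime (coprime-sym (1-coprimeTo k))

ℕ→ℚ-+ : ∀ a b → ℕ→ℚ (a ℕ.+ b) ≡ ℕ→ℚ a + ℕ→ℚ b
ℕ→ℚ-+ a b rewrite ℕ→ℚ≡mkℚ a | ℕ→ℚ≡mkℚ b =
  cong (ℚ._/ 1) (sym (cong₂ ℤ._+_ (ℤ.*-identityʳ (ℤ.+ a)) (ℤ.*-identityʳ (ℤ.+ b))))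

ℕ→ℚ-mono-≤ : ∀ {a b} → a ≤ b → ℕ→ℚ a ℚ.≤ ℕ→ℚ b
ℕ→ℚ-mono-≤ {a} {b} a≤b rewrite ℕ→ℚ≡mkℚ a | ℕ→ℚ≡mkℚ b =
  *≤* (ℤ.*-monoʳ-≤-nonNeg (ℤ.+ 1) (ℤ.+≤+ a≤b))

ℕ→ℚ-cancel-≤ : ∀ {a b} → ℕ→ℚ a ℚ.≤ ℕ→ℚ b → a ≤ b
ℕ→ℚ-cancel-≤ {a} {b} le rewrite ℕ→ℚ≡mkℚ a | ℕ→ℚ≡mkℚ b =
  ℤ.drop‿+≤+ (ℤ.*-cancelʳ-≤-pos (ℤ.+ a) (ℤ.+ b) (ℤ.+ 1) (ℚ.drop-*≤* le))

p<q⇒0<q-p : ∀ {p q} → p ℚ.< q → 0ℚ ℚ.< q - p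
p<q⇒0<q-p {p} {q} p<q = subst (ℚ._< q - p) (ℚ.+-inverseʳ p) (ℚ.+-monoˡ-< (- p) p<q)

convex-tight : ∀ {a b r t} → a ℚ.≤ r → b ℚ.≤ r → 0ℚ ℚ.< t → t ℚ.< 1ℚ →
               t * a + (1ℚ - t) * b ≡ r → a ≡ r × b ≡ r
convex-tight {a} {b} {r} {t} a≤r b≤r 0<t t<1 eq =
  ℚ.≤-antisym a≤r (ℚ.≮⇒≥ λ a<r →
    not-below (ℚ.+-mono-<-≤ (ℚ.*-monoʳ-<-pos t a<r) (ℚ.*-monoˡ-≤-nonNeg (1ℚ - t) b≤r))) ,
  ℚ.≤-antisym b≤r (ℚ.≮⇒≥ λ b<r →
    not-below (ℚ.+-mono-≤-< (ℚ.*-monoˡ-≤-nonNeg t a≤r) (ℚ.*-monoʳ-<-pos (1ℚ - t) b<r)))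
  where
  instance
    t-pos : ℚ.Positive t
    t-pos = ℚ.positive 0<t
    1-t-pos : ℚ.Positive (1ℚ - t)
    1-t-pos = ℚ.positive (p<q⇒0<q-p t<1)
    t-nonNeg : ℚ.NonNegative t
    t-nonNeg = ℚ.pos⇒nonNeg t
    1-t-nonNeg : ℚ.NonNegative (1ℚ - t)
    1-t-nonNeg = ℚ.pos⇒nonNeg (1ℚ - t)
  tr+[1-t]r≡r : ∀ t r → t * r + (1ℚ - t) * r ≡ r
  tr+[1-t]r≡r = solve-∀ ℚ-ring
  not-below : ¬ (t * a + (1ℚ - t) * b ℚ.< t * r + (1ℚ - t) * r)
  not-below = ℚ.<-irrefl (trans eq (sym (tr+[1-t]r≡r t r)))

+-tight : ∀ {a b p q} → a ℚ.≤ p → b ℚ.≤ q → p + q ℚ.≤ a + b → a ≡ p × b ≡ q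
+-tight a≤p b≤q p+q≤a+b =
  ℚ.≤-antisym a≤p (ℚ.≮⇒≥ λ a<p → ℚ.<-irrefl refl (ℚ.<-≤-trans (ℚ.+-mono-<-≤ a<p b≤q) p+q≤a+b)) ,
  ℚ.≤-antisym b≤q (ℚ.≮⇒≥ λ b<q → ℚ.<-irrefl refl (ℚ.<-≤-trans (ℚ.+-mono-≤-< a≤p b<q) p+q≤a+b))

perturb-≤ : ∀ a {ε} k m → 0ℚ ℚ.≤ ε → k ≤ 1 → a + ε * ℕ→ℚ k + (- ε) * ℕ→ℚ m ℚ.≤ a + ε
perturb-≤ a {ε} k m 0≤ε k≤1 = begin
  a + ε * ℕ→ℚ k + (- ε) * ℕ→ℚ m  ≤⟨ ℚ.+-monoʳ-≤ (a + ε * ℕ→ℚ k) -εm≤0 ⟩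
  a + ε * ℕ→ℚ k + 0ℚ             ≡⟨ ℚ.+-identityʳ _ ⟩
  a + ε * ℕ→ℚ k                  ≤⟨ ℚ.+-monoʳ-≤ a (ℚ.*-monoˡ-≤-nonNeg ε (ℕ→ℚ-mono-≤ k≤1)) ⟩
  a + ε * 1ℚ                     ≡⟨ cong (a +_) (ℚ.*-identityʳ ε) ⟩
  a + ε                          ∎
  where
  open ℚ.≤-Reasoning
  instance
    ε-nonNeg : ℚ.NonNegative ε
    ε-nonNeg = ℚ.nonNegative 0≤ε
    -ε-nonPos : ℚ.NonPositive (- ε)
    -ε-nonPos = ℚ.nonPositive (ℚ.neg-antimono-≤ 0≤ε)
  -εm≤0 : (- ε) * ℕ→ℚ m ℚ.≤ 0ℚ
  -εm≤0 = subst ((- ε) * ℕ→ℚ m ℚ.≤_) (ℚ.*-zeroʳ (- ε))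
                (ℚ.*-monoˡ-≤-nonPos (- ε) (ℕ→ℚ-mono-≤ {0} {m} ℕ.z≤n))

minOver : ∀ n → (Subset n → ℚ) → ℚ
minOver ℕ.zero    g = g []
minOver (ℕ.suc n) g = minOver n (g ∘ (inside ∷_)) ⊓ minOver n (g ∘ (outside ∷_))

minOver-≤ : ∀ g (A : Subset n) → minOver n g ℚ.≤ g A
minOver-≤ g [] = ℚ.≤-refl
minOver-≤ {ℕ.suc n} g (true ∷ A) =
  ℚ.≤-trans (ℚ.p⊓q≤p (minOver n (g ∘ (inside ∷_))) _) (minOver-≤ (g ∘ (inside ∷_)) A)
minOver-≤ {ℕ.suc n} g (false ∷ A) =
  ℚ.≤-trans (ℚ.p⊓q≤q (minOver n (g ∘ (inside ∷_))) _) (minOver-≤ (g ∘ (outside ∷_)) A)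

minOver-pos : ∀ n g → (∀ (A : Subset n) → 0ℚ ℚ.< g A) → 0ℚ ℚ.< minOver n g
minOver-pos ℕ.zero    g pos = pos []
minOver-pos (ℕ.suc n) g pos with ℚ.⊓-sel (minOver n (g ∘ (inside ∷_))) (minOver n (g ∘ (outside ∷_)))
... | inj₁ eq = subst (0ℚ ℚ.<_) (sym eq) (minOver-pos n _ (pos ∘ (inside ∷_)))
... | inj₂ eq = subst (0ℚ ℚ.<_) (sym eq) (minOver-pos n _ (pos ∘ (outside ∷_)))

-- Subsets

x∈p∪⁅x⁆ : ∀ {x : Fin n} p → x ∈ p ∪ ⁅ x ⁆
x∈p∪⁅x⁆ {x = x} p = q⊆p∪q p ⁅ x ⁆ (x∈⁅x⁆ x)

p⊆q∧x∈q⇒p∪⁅x⁆⊆q : ∀ {x : Fin n} {p q} → p ⊆ q → x ∈ q → p ∪ ⁅ x ⁆ ⊆ q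
p⊆q∧x∈q⇒p∪⁅x⁆⊆q {x = x} {p} {q} p⊆q x∈q =
  [ p⊆q , (λ y∈⁅x⁆ → subst (_∈ q) (sym (x∈⁅y⁆⇒x≡y x y∈⁅x⁆)) x∈q) ]′ ∘ x∈p∪q⁻ p ⁅ x ⁆

x∈p⇒p∪⁅x⁆≡p : ∀ {x : Fin n} {p} → x ∈ p → p ∪ ⁅ x ⁆ ≡ p
x∈p⇒p∪⁅x⁆≡p {p = _ ∷ p} here        = cong (inside ∷_) (∪-identityʳ p)
x∈p⇒p∪⁅x⁆≡p {p = s ∷ p} (there x∈p) = cong₂ _∷_ (∨-identityʳ s) (x∈p⇒p∪⁅x⁆≡p x∈p)

x∉p-x : ∀ {x : Fin n} p → x ∉ p Subset.- x
x∉p-x {x = suc x} (_ ∷ p) (there x∈p-x) = x∉p-x p x∈p-x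

x∈p⇒p-x∪⁅x⁆≡p : ∀ {x : Fin n} {p} → x ∈ p → (p Subset.- x) ∪ ⁅ x ⁆ ≡ p
x∈p⇒p-x∪⁅x⁆≡p {p = _ ∷ p} here        = cong (inside ∷_) (trans (∪-identityʳ _) (p─⊥≡p p))
x∈p⇒p-x∪⁅x⁆≡p {p = s ∷ p} (there x∈p) = cong₂ _∷_ (∨-identityʳ s) (x∈p⇒p-x∪⁅x⁆≡p x∈p)

⊆⇒≡⊎⊂ : ∀ {p q : Subset n} → p ⊆ q → p ≡ q ⊎ p ⊂ q
⊆⇒≡⊎⊂ {p = p} {q} p⊆q with p ⊂? q
... | yes p⊂q = inj₂ p⊂q
... | no  p⊄q = inj₁ (⊆-antisym p⊆q λ {x} x∈q →
                  decidable-stable (x ∈? p) λ x∉p → p⊄q (p⊆q , x , x∈q , x∉p))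

x∉p⇒p∩⁅x⁆≡⊥ : ∀ {x : Fin n} {p} → x ∉ p → p ∩ ⁅ x ⁆ ≡ ⊥
x∉p⇒p∩⁅x⁆≡⊥ {x = zero}  {outside ∷ p} _   = cong (outside ∷_) (∩-zeroʳ p)
x∉p⇒p∩⁅x⁆≡⊥ {x = zero}  {inside ∷ p}  x∉p = contradiction here x∉p
x∉p⇒p∩⁅x⁆≡⊥ {x = suc x} {s ∷ p}       x∉p = cong₂ _∷_ (∧-zeroʳ s) (x∉p⇒p∩⁅x⁆≡⊥ (x∉p ∘ there))

x∈p⇒p∩⁅x⁆≡⁅x⁆ : ∀ {x : Fin n} {p} → x ∈ p → p ∩ ⁅ x ⁆ ≡ ⁅ x ⁆
x∈p⇒p∩⁅x⁆≡⁅x⁆ {p = _ ∷ p} here        = cong (inside ∷_) (∩-zeroʳ p)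
x∈p⇒p∩⁅x⁆≡⁅x⁆ {p = s ∷ p} (there x∈p) = cong₂ _∷_ (∧-zeroʳ s) (x∈p⇒p∩⁅x⁆≡⁅x⁆ x∈p)

x∉p⇒∣p∪⁅x⁆∣≡1+∣p∣ : ∀ {x : Fin n} {p} → x ∉ p → ∣ p ∪ ⁅ x ⁆ ∣ ≡ ℕ.suc ∣ p ∣
x∉p⇒∣p∪⁅x⁆∣≡1+∣p∣ {x = zero}  {outside ∷ p} _   = cong (ℕ.suc ∘ ∣_∣) (∪-identityʳ p)
x∉p⇒∣p∪⁅x⁆∣≡1+∣p∣ {x = zero}  {inside ∷ p}  x∉p = contradiction here x∉p
x∉p⇒∣p∪⁅x⁆∣≡1+∣p∣ {x = suc x} {inside ∷ p}  x∉p = cong ℕ.suc (x∉p⇒∣p∪⁅x⁆∣≡1+∣p∣ (x∉p ∘ there))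
x∉p⇒∣p∪⁅x⁆∣≡1+∣p∣ {x = suc x} {outside ∷ p} x∉p = x∉p⇒∣p∪⁅x⁆∣≡1+∣p∣ (x∉p ∘ there)

x∉p⇒∣p∩[q∪⁅x⁆]∣≡∣p∩q∣ : ∀ {x : Fin n} {p} q → x ∉ p → ∣ p ∩ (q ∪ ⁅ x ⁆) ∣ ≡ ∣ p ∩ q ∣
x∉p⇒∣p∩[q∪⁅x⁆]∣≡∣p∩q∣ {x = x} {p} q x∉p = cong ∣_∣ (begin
  p ∩ (q ∪ ⁅ x ⁆)        ≡⟨ ∩-distribˡ-∪ p q ⁅ x ⁆ ⟩
  (p ∩ q) ∪ (p ∩ ⁅ x ⁆)  ≡⟨ cong ((p ∩ q) ∪_) (x∉p⇒p∩⁅x⁆≡⊥ x∉p) ⟩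
  (p ∩ q) ∪ ⊥            ≡⟨ ∪-identityʳ (p ∩ q) ⟩
  p ∩ q                  ∎)
  where open ≡-Reasoning

x∈p∖q⇒∣p∩[q∪⁅x⁆]∣≡1+∣p∩q∣ : ∀ {x : Fin n} {p q} → x ∈ p → x ∉ q →
                            ∣ p ∩ (q ∪ ⁅ x ⁆) ∣ ≡ ℕ.suc ∣ p ∩ q ∣
x∈p∖q⇒∣p∩[q∪⁅x⁆]∣≡1+∣p∩q∣ {x = x} {p} {q} x∈p x∉q = begin
  ∣ p ∩ (q ∪ ⁅ x ⁆) ∣        ≡⟨ cong ∣_∣ (∩-distribˡ-∪ p q ⁅ x ⁆) ⟩
  ∣ (p ∩ q) ∪ (p ∩ ⁅ x ⁆) ∣  ≡⟨ cong (λ r → ∣ (p ∩ q) ∪ r ∣) (x∈p⇒p∩⁅x⁆≡⁅x⁆ x∈p) ⟩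
  ∣ (p ∩ q) ∪ ⁅ x ⁆ ∣        ≡⟨ x∉p⇒∣p∪⁅x⁆∣≡1+∣p∣ (x∉q ∘ p∩q⊆q p q) ⟩
  ℕ.suc ∣ p ∩ q ∣            ∎
  where open ≡-Reasoning

x∉q⇒∣[p∪⁅x⁆]∩q∣≡∣p∩q∣ : ∀ {x : Fin n} p {q} → x ∉ q → ∣ (p ∪ ⁅ x ⁆) ∩ q ∣ ≡ ∣ p ∩ q ∣
x∉q⇒∣[p∪⁅x⁆]∩q∣≡∣p∩q∣ {x = x} p {q} x∉q = begin
  ∣ (p ∪ ⁅ x ⁆) ∩ q ∣  ≡⟨ cong ∣_∣ (∩-comm (p ∪ ⁅ x ⁆) q) ⟩
  ∣ q ∩ (p ∪ ⁅ x ⁆) ∣  ≡⟨ x∉p⇒∣p∩[q∪⁅x⁆]∣≡∣p∩q∣ p x∉q ⟩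
  ∣ q ∩ p ∣            ≡⟨ cong ∣_∣ (∩-comm q p) ⟩
  ∣ p ∩ q ∣            ∎
  where open ≡-Reasoning

∣p∩⁅x⁆∣≤1 : ∀ (p : Subset n) x → ∣ p ∩ ⁅ x ⁆ ∣ ≤ 1
∣p∩⁅x⁆∣≤1 p x = subst (∣ p ∩ ⁅ x ⁆ ∣ ≤_) (∣⁅x⁆∣≡1 x) (∣p∩q∣≤∣q∣ p ⁅ x ⁆)

-- Sums over subsets

sumFin-cong : ∀ n {f g : Fin n → ℚ} → (∀ i → f i ≡ g i) → sumFin n f ≡ sumFin n g
sumFin-cong ℕ.zero    f≡g = refl
sumFin-cong (ℕ.suc n) f≡g = cong₂ _+_ (f≡g zero) (sumFin-cong n (f≡g ∘ suc))

sumFin-+ : ∀ n (f g : Fin n → ℚ) → sumFin n (λ i → f i + g i) ≡ sumFin n f + sumFin n g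
sumFin-+ ℕ.zero    f g = refl
sumFin-+ (ℕ.suc n) f g = trans (cong ((f zero + g zero) +_) (sumFin-+ n (f ∘ suc) (g ∘ suc)))
                               (interchange (f zero) (g zero) (sumFin n (f ∘ suc)) (sumFin n (g ∘ suc)))

sumFin-* : ∀ n c (f : Fin n → ℚ) → sumFin n (λ i → c * f i) ≡ c * sumFin n f
sumFin-* ℕ.zero    c f = sym (ℚ.*-zeroʳ c)
sumFin-* (ℕ.suc n) c f =
  trans (cong (c * f zero +_) (sumFin-* n c (f ∘ suc))) (sym (ℚ.*-distribˡ-+ c _ _))

sumOver-cong : ∀ (A : Subset n) {f g} → (∀ i → f i ≡ g i) → sumOver A f ≡ sumOver A g
sumOver-cong {n} A f≡g = sumFin-cong n (λ i → cong (if lookup A i then_else 0ℚ) (f≡g i))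

sumOver-+ : ∀ (A : Subset n) f g → sumOver A (λ i → f i + g i) ≡ sumOver A f + sumOver A g
sumOver-+ {n} A f g = trans (sumFin-cong n (λ i → if-+ (lookup A i))) (sumFin-+ n _ _)
  where
  if-+ : ∀ {a b} s → (if s then a + b else 0ℚ) ≡ (if s then a else 0ℚ) + (if s then b else 0ℚ)
  if-+ true  = refl
  if-+ false = refl

sumOver-* : ∀ (A : Subset n) c f → sumOver A (λ i → c * f i) ≡ c * sumOver A f
sumOver-* {n} A c f = trans (sumFin-cong n (λ i → if-* (lookup A i))) (sumFin-* n c _)
  where
  if-* : ∀ {a} s → (if s then c * a else 0ℚ) ≡ c * (if s then a else 0ℚ)
  if-* true  = refl
  if-* false = sym (ℚ.*-zeroʳ c)

sumOver-∪-∩ : ∀ (A B : Subset n) f →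
              sumOver (A ∪ B) f + sumOver (A ∩ B) f ≡ sumOver A f + sumOver B f
sumOver-∪-∩ {n} A B f = begin
  sumOver (A ∪ B) f + sumOver (A ∩ B) f
    ≡⟨ sumFin-+ n _ _ ⟨
  sumFin n (λ i → (if lookup (A ∪ B) i then f i else 0ℚ) + (if lookup (A ∩ B) i then f i else 0ℚ))
    ≡⟨ sumFin-cong n pointwise ⟩
  sumFin n (λ i → (if lookup A i then f i else 0ℚ) + (if lookup B i then f i else 0ℚ))
    ≡⟨ sumFin-+ n _ _ ⟩
  sumOver A f + sumOver B f
    ∎
  where
  open ≡-Reasoning
  if-∨-∧ : ∀ {a} s t → (if s ∨ t then a else 0ℚ) + (if s ∧ t then a else 0ℚ)
                    ≡ (if s then a else 0ℚ) + (if t then a else 0ℚ)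
  if-∨-∧     true  t     = refl
  if-∨-∧ {a} false true  = ℚ.+-comm a 0ℚ
  if-∨-∧     false false = refl
  pointwise : ∀ i → (if lookup (A ∪ B) i then f i else 0ℚ) + (if lookup (A ∩ B) i then f i else 0ℚ)
                  ≡ (if lookup A i then f i else 0ℚ) + (if lookup B i then f i else 0ℚ)
  pointwise i rewrite lookup-zipWith _∨_ i A B | lookup-zipWith _∧_ i A B =
    if-∨-∧ (lookup A i) (lookup B i)

sumOver-⊥ : ∀ (f : Fin n → ℚ) → sumOver ⊥ f ≡ 0ℚ
sumOver-⊥ {ℕ.zero}  f = refl
sumOver-⊥ {ℕ.suc n} f = cong (0ℚ +_) (sumOver-⊥ (f ∘ suc))

sumOver-⁅⁆ : ∀ (e : Fin n) f → sumOver ⁅ e ⁆ f ≡ f e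
sumOver-⁅⁆ zero    f = trans (cong (f zero +_) (sumOver-⊥ (f ∘ suc))) (ℚ.+-identityʳ (f zero))
sumOver-⁅⁆ (suc e) f = trans (ℚ.+-identityˡ _) (sumOver-⁅⁆ e (f ∘ suc))

sumOver-∪⁅⁆ : ∀ {e : Fin n} {S} f → e ∉ S → sumOver (S ∪ ⁅ e ⁆) f ≡ sumOver S f + f e
sumOver-∪⁅⁆ {e = e} {S} f e∉S = begin
  sumOver (S ∪ ⁅ e ⁆) f                          ≡⟨ ℚ.+-identityʳ _ ⟨
  sumOver (S ∪ ⁅ e ⁆) f + 0ℚ                     ≡⟨ cong (sumOver (S ∪ ⁅ e ⁆) f +_) sum-S∩e≡0 ⟨
  sumOver (S ∪ ⁅ e ⁆) f + sumOver (S ∩ ⁅ e ⁆) f  ≡⟨ sumOver-∪-∩ S ⁅ e ⁆ f ⟩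
  sumOver S f + sumOver ⁅ e ⁆ f                  ≡⟨ cong (sumOver S f +_) (sumOver-⁅⁆ e f) ⟩
  sumOver S f + f e                              ∎
  where
  open ≡-Reasoning
  sum-S∩e≡0 : sumOver (S ∩ ⁅ e ⁆) f ≡ 0ℚ
  sum-S∩e≡0 = trans (cong (λ T → sumOver T f) (x∉p⇒p∩⁅x⁆≡⊥ e∉S)) (sumOver-⊥ f)

𝟙 : Subset n → Fin n → ℚ
𝟙 B i = if lookup B i then 1ℚ else 0ℚ

𝟙-∈ : ∀ {B : Subset n} {i} → i ∈ B → 𝟙 B i ≡ 1ℚ
𝟙-∈ i∈B = cong (if_then 1ℚ else 0ℚ) ([]=⇒lookup i∈B)

𝟙-∉ : ∀ {B : Subset n} {i} → i ∉ B → 𝟙 B i ≡ 0ℚ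
𝟙-∉ {B = B} {i} i∉B with lookup B i in eq
... | true  = contradiction (lookup⇒[]= i B eq) i∉B
... | false = refl

𝟙-support : ∀ (B : Subset n) → IsSupport (𝟙 B) B
𝟙-support B i with i ∈? B
... | yes i∈B = (λ _ 𝟙≡0 → ℚ.1≢0 (trans (sym (𝟙-∈ i∈B)) 𝟙≡0)) , (λ _ → i∈B)
... | no  i∉B = (λ i∈B → contradiction i∈B i∉B) , (λ 𝟙≢0 → contradiction (𝟙-∉ i∉B) 𝟙≢0)

01-vector≡𝟙 : ∀ {x : Fin n → ℚ} {B} → (∀ i → x i ≡ 0ℚ ⊎ x i ≡ 1ℚ) → IsSupport x B →
              ∀ i → x i ≡ 𝟙 B i
01-vector≡𝟙 {B = B} x∈01 supp i with i ∈? B | x∈01 i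
... | yes i∈B | inj₁ xi≡0 = contradiction xi≡0 (proj₁ (supp i) i∈B)
... | yes i∈B | inj₂ xi≡1 = trans xi≡1 (sym (𝟙-∈ i∈B))
... | no  i∉B | inj₁ xi≡0 = trans xi≡0 (sym (𝟙-∉ i∉B))
... | no  i∉B | inj₂ xi≡1 = contradiction (proj₂ (supp i) λ xi≡0 → ℚ.1≢0 (trans (sym xi≡1) xi≡0)) i∉B

sumOver-𝟙 : ∀ (A B : Subset n) → sumOver A (𝟙 B) ≡ ℕ→ℚ ∣ A ∩ B ∣
sumOver-𝟙 []          []          = refl
sumOver-𝟙 (true ∷ A)  (true ∷ B)  = trans (cong (1ℚ +_) (sumOver-𝟙 A B)) (sym (ℕ→ℚ-+ 1 ∣ A ∩ B ∣))
sumOver-𝟙 (true ∷ A)  (false ∷ B) = trans (ℚ.+-identityˡ _) (sumOver-𝟙 A B)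
sumOver-𝟙 (false ∷ A) (_ ∷ B)     = trans (ℚ.+-identityˡ _) (sumOver-𝟙 A B)

-- The base polyhedron and chains

module BasePolyhedron {n : ℕ} (D : Subset n → Set) (ρ : Subset n → ℕ) where

  Tight : (Fin n → ℚ) → Subset n → Set
  Tight x A = D A × sumOver A x ≡ ℕ→ℚ (ρ A)

  tight-face : ∀ {x y z : Fin n → ℚ} {t A} →
               InBasePolyhedron n D ρ y → InBasePolyhedron n D ρ z → 0ℚ ℚ.< t → t ℚ.< 1ℚ →
               (∀ i → x i ≡ t * y i + (1ℚ - t) * z i) → Tight x A → Tight y A × Tight z A
  tight-face {x} {y} {z} {t} {A} y∈P z∈P 0<t t<1 x≡ty+[1-t]z (dA , x-tight) =
    (dA , proj₁ y,z-tight) , (dA , proj₂ y,z-tight)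
    where
    open ≡-Reasoning
    y,z-tight : sumOver A y ≡ ℕ→ℚ (ρ A) × sumOver A z ≡ ℕ→ℚ (ρ A)
    y,z-tight = convex-tight (proj₁ y∈P A dA) (proj₁ z∈P A dA) 0<t t<1 (begin
      t * sumOver A y + (1ℚ - t) * sumOver A z
        ≡⟨ cong₂ _+_ (sumOver-* A t y) (sumOver-* A (1ℚ - t) z) ⟨
      sumOver A (λ i → t * y i) + sumOver A (λ i → (1ℚ - t) * z i)
        ≡⟨ sumOver-+ A _ _ ⟨
      sumOver A (λ i → t * y i + (1ℚ - t) * z i)
        ≡⟨ sumOver-cong A x≡ty+[1-t]z ⟨
      sumOver A x
        ≡⟨ x-tight ⟩
      ℕ→ℚ (ρ A)
        ∎)

  data Chain : Subset n → Set where
    base : Chain ⊥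
    step : ∀ {S} → Chain S → (e : Fin n) → e ∉ S → D (S ∪ ⁅ e ⁆) → Chain (S ∪ ⁅ e ⁆)

  data _∈ᶜ_ : ∀ {S} → Subset n → Chain S → Set where
    top   : ∀ {S} {c : Chain S} → S ∈ᶜ c
    below : ∀ {S A} {c : Chain S} {e e∉S d} → A ∈ᶜ c → A ∈ᶜ step c e e∉S d

  ∈ᶜ-⊆ : ∀ {S A} {c : Chain S} → A ∈ᶜ c → A ⊆ S
  ∈ᶜ-⊆ top                 = id
  ∈ᶜ-⊆ (below {e = e} A∈c) = p⊆p∪q ⁅ e ⁆ ∘ ∈ᶜ-⊆ A∈c

  chain-sums-determine : ∀ {S} (c : Chain S) {y z : Fin n → ℚ} →
                         (∀ {A} → A ∈ᶜ c → sumOver A y ≡ sumOver A z) → ∀ {i} → i ∈ S → y i ≡ z i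
  chain-sums-determine base _ i∈⊥ = contradiction i∈⊥ ∉⊥
  chain-sums-determine (step {S} c e e∉S _) {y} {z} agree i∈S∪e with x∈p∪q⁻ S ⁅ e ⁆ i∈S∪e
  ... | inj₁ i∈S   = chain-sums-determine c (agree ∘ below) i∈S
  ... | inj₂ i∈⁅e⁆ = subst (λ j → y j ≡ z j) (sym (x∈⁅y⁆⇒x≡y e i∈⁅e⁆))
    (∙-cancelˡ (sumOver S y) (y e) (z e) (begin
      sumOver S y + y e      ≡⟨ sumOver-∪⁅⁆ y e∉S ⟨
      sumOver (S ∪ ⁅ e ⁆) y  ≡⟨ agree top ⟩
      sumOver (S ∪ ⁅ e ⁆) z  ≡⟨ sumOver-∪⁅⁆ z e∉S ⟩
      sumOver S z + z e      ≡⟨ cong (_+ z e) (agree (below top)) ⟨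
      sumOver S y + z e      ∎))
    where open ≡-Reasoning

  chain-tight⇒vertex : ∀ {x} (c : Chain ⊤) → InBasePolyhedron n D ρ x →
                       (∀ {A} → A ∈ᶜ c → Tight x A) → IsVertex n D ρ x
  chain-tight⇒vertex c x∈P x-tight = x∈P , λ y z t y∈P z∈P 0<t t<1 x≡ty+[1-t]z e →
    chain-sums-determine c (λ A∈c → sums-agree (tight-face y∈P z∈P 0<t t<1 x≡ty+[1-t]z (x-tight A∈c))) ∈⊤
    where
    sums-agree : ∀ {y z A} → Tight y A × Tight z A → sumOver A y ≡ sumOver A z
    sums-agree ((_ , y-tight) , (_ , z-tight)) = trans y-tight (sym z-tight)

-- U-matroids

module UMatroid {n : ℕ} {D : Subset n → Set} {ρ : Subset n → ℕ} (M : IsUMatroid n D ρ) where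
  open IsUMatroid M
  open BasePolyhedron D ρ

  ρ[S∪⁅e⁆]≡ρS∨1+ρS : ∀ {S e} → D S → D (S ∪ ⁅ e ⁆) →
                     ρ (S ∪ ⁅ e ⁆) ≡ ρ S ⊎ ρ (S ∪ ⁅ e ⁆) ≡ ℕ.suc (ρ S)
  ρ[S∪⁅e⁆]≡ρS∨1+ρS {S} {e} dS dS∪e with ℕ.m≤n⇒m<n∨m≡n (ρ-unit S e dS dS∪e)
  ... | inj₁ ρ<1+ρ = inj₁ (ℕ.≤-antisym (ℕ.m<1+n⇒m≤n ρ<1+ρ) (ρ-mono S _ dS dS∪e (p⊆p∪q ⁅ e ⁆)))
  ... | inj₂ ρ≡1+ρ = inj₂ ρ≡1+ρ

  ρ-∩-mono : ∀ {T S S′} → D T → D S → D S′ → S ⊆ S′ → ρ (T ∩ S) ≤ ρ (T ∩ S′)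
  ρ-∩-mono {T} {S} {S′} dT dS dS′ S⊆S′ =
    ρ-mono _ _ (D-∩ T S dT dS) (D-∩ T S′ dT dS′) λ i∈T∩S →
      let i∈T , i∈S = x∈p∩q⁻ T S i∈T∩S in x∈p∩q⁺ (i∈T , S⊆S′ i∈S)

  ρ-jump⇒ρ-∩-jump : ∀ {S T e} → D S → D T → D (S ∪ ⁅ e ⁆) → e ∈ T →
                    ρ (S ∪ ⁅ e ⁆) ≡ ℕ.suc (ρ S) → ℕ.suc (ρ (T ∩ S)) ≤ ρ (T ∩ (S ∪ ⁅ e ⁆))
  ρ-jump⇒ρ-∩-jump {S} {T} {e} dS dT dS∪e e∈T jump = ℕ.+-cancelʳ-≤ (ρ S) _ _ (begin
    ℕ.suc (ρ (T ∩ S)) ℕ.+ ρ S    ≡⟨ cong ℕ.suc (ℕ.+-comm (ρ (T ∩ S)) (ρ S)) ⟩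
    ℕ.suc (ρ S) ℕ.+ ρ (T ∩ S)    ≡⟨ cong (ℕ._+ ρ (T ∩ S)) jump ⟨
    ρ (S ∪ ⁅ e ⁆) ℕ.+ ρ (T ∩ S)  ≤⟨ ℕ.+-mono-≤ (ρ-mono _ _ dS∪e (D-∪ X S dX dS) S∪e⊆X∪S)
                                              (ρ-mono _ _ (D-∩ T S dT dS) (D-∩ X S dX dS) T∩S⊆X∩S) ⟩
    ρ (X ∪ S) ℕ.+ ρ (X ∩ S)      ≤⟨ ρ-submod X S dX dS ⟩
    ρ X ℕ.+ ρ S                  ∎)
    where
    open ℕ.≤-Reasoning
    X : Subset n
    X = T ∩ (S ∪ ⁅ e ⁆)
    dX : D X
    dX = D-∩ T _ dT dS∪e
    S∪e⊆X∪S : S ∪ ⁅ e ⁆ ⊆ X ∪ S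
    S∪e⊆X∪S = p⊆q∧x∈q⇒p∪⁅x⁆⊆q (q⊆p∪q X S) (p⊆p∪q S (x∈p∩q⁺ (e∈T , x∈p∪⁅x⁆ S)))
    T∩S⊆X∩S : T ∩ S ⊆ X ∩ S
    T∩S⊆X∩S i∈T∩S = let i∈T , i∈S = x∈p∩q⁻ T S i∈T∩S in
      x∈p∩q⁺ (x∈p∩q⁺ (i∈T , p⊆p∪q ⁅ e ⁆ i∈S) , i∈S)

  chain-D : ∀ {S} → Chain S → D S
  chain-D base           = D-empty
  chain-D (step _ _ _ d) = d

  ∈ᶜ-D : ∀ {S A} {c : Chain S} → A ∈ᶜ c → D A
  ∈ᶜ-D {c = c} top = chain-D c
  ∈ᶜ-D (below A∈c) = ∈ᶜ-D A∈c

  chain : ∀ {A} → Acc _⊂_ A → D A → Chain A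
  chain {A} (acc rs) dA with nonempty? A
  ... | no  A-empty = subst Chain (sym (Empty-unique A-empty)) base
  ... | yes A-nonempty with D-accessible A dA A-nonempty
  ...   | x , x∈A , dA-x =
    subst Chain A-x∪x≡A (step (chain (rs (x∈p⇒p-x⊂p x∈A)) dA-x) x (x∉p-x A) (subst D (sym A-x∪x≡A) dA))
    where
    A-x∪x≡A : (A Subset.- x) ∪ ⁅ x ⁆ ≡ A
    A-x∪x≡A = x∈p⇒p-x∪⁅x⁆≡p x∈A

  ChainThrough : Subset n → Subset n → Set
  ChainThrough A S = Σ (Chain S) (A ∈ᶜ_)

  chain-through-∪ : ∀ {A S} → Chain A → Chain S → ChainThrough A (A ∪ S)
  chain-through-∪ {A} cA base = subst (ChainThrough A) (sym (∪-identityʳ A)) (cA , top)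
  chain-through-∪ {A} cA (step {S} cS e _ dS∪e) with chain-through-∪ cA cS | e ∈? A ∪ S
  ... | c , A∈c | yes e∈A∪S =
    subst (ChainThrough A) (trans (sym (x∈p⇒p∪⁅x⁆≡p e∈A∪S)) (∪-assoc A S ⁅ e ⁆)) (c , A∈c)
  ... | c , A∈c | no  e∉A∪S =
    subst (ChainThrough A) (∪-assoc A S ⁅ e ⁆) (step c e e∉A∪S dA∪S∪e , below A∈c)
    where
    dA∪S∪e : D ((A ∪ S) ∪ ⁅ e ⁆)
    dA∪S∪e = subst D (sym (∪-assoc A S ⁅ e ⁆)) (D-∪ A _ (chain-D cA) dS∪e)

  chain-through : ∀ {A} → D A → ChainThrough A ⊤
  chain-through {A} dA = subst (ChainThrough A) (∪-zeroʳ A)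
    (chain-through-∪ (chain (⊂-wellFounded A) dA) (chain (⊂-wellFounded ⊤) D-full))

  greedy : ∀ {S} → Chain S → Subset n
  greedy base = ⊥
  greedy (step c e _ d) with ρ[S∪⁅e⁆]≡ρS∨1+ρS (chain-D c) d
  ... | inj₁ _ = greedy c
  ... | inj₂ _ = greedy c ∪ ⁅ e ⁆

  greedy-⊆ : ∀ {S} (c : Chain S) → greedy c ⊆ S
  greedy-⊆ base = id
  greedy-⊆ (step {S} c e _ d) with ρ[S∪⁅e⁆]≡ρS∨1+ρS (chain-D c) d
  ... | inj₁ _ = p⊆p∪q ⁅ e ⁆ ∘ greedy-⊆ c
  ... | inj₂ _ = p⊆q∧x∈q⇒p∪⁅x⁆⊆q (p⊆p∪q ⁅ e ⁆ ∘ greedy-⊆ c) (x∈p∪⁅x⁆ S)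

  greedy-≤ : ∀ {S T} (c : Chain S) → D T → ∣ T ∩ greedy c ∣ ≤ ρ (T ∩ S)
  greedy-≤ {T = T} base dT =
    subst (_≤ ρ (T ∩ ⊥)) (sym (trans (cong ∣_∣ (∩-zeroʳ T)) (∣⊥∣≡0 n))) ℕ.z≤n
  greedy-≤ {T = T} (step {S} c e e∉S d) dT with ρ[S∪⁅e⁆]≡ρS∨1+ρS (chain-D c) d | e ∈? T
  ... | inj₁ _    | _       = ℕ.≤-trans (greedy-≤ c dT) (ρ-∩-mono dT (chain-D c) d (p⊆p∪q ⁅ e ⁆))
  ... | inj₂ _    | no  e∉T = begin
    ∣ T ∩ (greedy c ∪ ⁅ e ⁆) ∣  ≡⟨ x∉p⇒∣p∩[q∪⁅x⁆]∣≡∣p∩q∣ (greedy c) e∉T ⟩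
    ∣ T ∩ greedy c ∣           ≤⟨ greedy-≤ c dT ⟩
    ρ (T ∩ S)                  ≤⟨ ρ-∩-mono dT (chain-D c) d (p⊆p∪q ⁅ e ⁆) ⟩
    ρ (T ∩ (S ∪ ⁅ e ⁆))        ∎
    where open ℕ.≤-Reasoning
  ... | inj₂ jump | yes e∈T = begin
    ∣ T ∩ (greedy c ∪ ⁅ e ⁆) ∣  ≡⟨ x∈p∖q⇒∣p∩[q∪⁅x⁆]∣≡1+∣p∩q∣ e∈T (e∉S ∘ greedy-⊆ c) ⟩
    ℕ.suc ∣ T ∩ greedy c ∣     ≤⟨ ℕ.s≤s (greedy-≤ c dT) ⟩
    ℕ.suc (ρ (T ∩ S))          ≤⟨ ρ-jump⇒ρ-∩-jump (chain-D c) dT d e∈T jump ⟩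
    ρ (T ∩ (S ∪ ⁅ e ⁆))        ∎
    where open ℕ.≤-Reasoning

  greedy-tight : ∀ {S A} (c : Chain S) → A ∈ᶜ c → ∣ A ∩ greedy c ∣ ≡ ρ A
  greedy-tight base top = trans (cong ∣_∣ (∩-zeroʳ {n} ⊥)) (trans (∣⊥∣≡0 n) (sym ρ-empty))
  greedy-tight (step {S} c e e∉S d) A∈c with ρ[S∪⁅e⁆]≡ρS∨1+ρS (chain-D c) d | A∈c
  ... | inj₁ same | top = begin
    ∣ (S ∪ ⁅ e ⁆) ∩ greedy c ∣  ≡⟨ x∉q⇒∣[p∪⁅x⁆]∩q∣≡∣p∩q∣ S (e∉S ∘ greedy-⊆ c) ⟩
    ∣ S ∩ greedy c ∣           ≡⟨ greedy-tight c top ⟩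
    ρ S                        ≡⟨ same ⟨
    ρ (S ∪ ⁅ e ⁆)              ∎
    where open ≡-Reasoning
  ... | inj₂ jump | top = begin
    ∣ (S ∪ ⁅ e ⁆) ∩ (greedy c ∪ ⁅ e ⁆) ∣  ≡⟨ x∈p∖q⇒∣p∩[q∪⁅x⁆]∣≡1+∣p∩q∣ (x∈p∪⁅x⁆ S) (e∉S ∘ greedy-⊆ c) ⟩
    ℕ.suc ∣ (S ∪ ⁅ e ⁆) ∩ greedy c ∣     ≡⟨ cong ℕ.suc (x∉q⇒∣[p∪⁅x⁆]∩q∣≡∣p∩q∣ S (e∉S ∘ greedy-⊆ c)) ⟩
    ℕ.suc ∣ S ∩ greedy c ∣               ≡⟨ cong ℕ.suc (greedy-tight c top) ⟩
    ℕ.suc (ρ S)                          ≡⟨ jump ⟨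
    ρ (S ∪ ⁅ e ⁆)                        ∎
    where open ≡-Reasoning
  ... | inj₁ _ | below A∈c′ = greedy-tight c A∈c′
  ... | inj₂ _ | below A∈c′ =
    trans (x∉p⇒∣p∩[q∪⁅x⁆]∣≡∣p∩q∣ (greedy c) (e∉S ∘ ∈ᶜ-⊆ A∈c′)) (greedy-tight c A∈c′)

  greedy-isBasis : (c : Chain ⊤) → IsBasis n D ρ (greedy c)
  greedy-isBasis c = 𝟙 (greedy c) , chain-tight⇒vertex c 𝟙B∈P 𝟙B-tight , 𝟙-support (greedy c)
    where
    𝟙B-tight : ∀ {A} → A ∈ᶜ c → Tight (𝟙 (greedy c)) A
    𝟙B-tight {A} A∈c = ∈ᶜ-D A∈c , trans (sumOver-𝟙 A (greedy c)) (cong ℕ→ℚ (greedy-tight c A∈c))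
    𝟙B∈P : InBasePolyhedron n D ρ (𝟙 (greedy c))
    𝟙B∈P = (λ T dT → subst (λ X → sumOver T (𝟙 (greedy c)) ℚ.≤ ℕ→ℚ (ρ X)) (∩-identityʳ T)
                         (subst (ℚ._≤ ℕ→ℚ (ρ (T ∩ ⊤))) (sym (sumOver-𝟙 T (greedy c)))
                           (ℕ→ℚ-mono-≤ (greedy-≤ c dT))))
         , proj₂ (𝟙B-tight top)

  module Vertex {x : Fin n → ℚ} (x-vertex : IsVertex n D ρ x) where

    x∈P : InBasePolyhedron n D ρ x
    x∈P = proj₁ x-vertex

    tight-⊥ : Tight x ⊥
    tight-⊥ = D-empty , trans (sumOver-⊥ x) (cong ℕ→ℚ (sym ρ-empty))

    tight-⊤ : Tight x ⊤
    tight-⊤ = D-full , proj₂ x∈P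

    tight-∪-∩ : ∀ {S T} → Tight x S → Tight x T → Tight x (S ∪ T) × Tight x (S ∩ T)
    tight-∪-∩ {S} {T} (dS , S-tight) (dT , T-tight) =
      (dS∪T , proj₁ ∪,∩-tight) , (dS∩T , proj₂ ∪,∩-tight)
      where
      open ℚ.≤-Reasoning
      dS∪T : D (S ∪ T)
      dS∪T = D-∪ S T dS dT
      dS∩T : D (S ∩ T)
      dS∩T = D-∩ S T dS dT
      ∪,∩-tight : sumOver (S ∪ T) x ≡ ℕ→ℚ (ρ (S ∪ T)) × sumOver (S ∩ T) x ≡ ℕ→ℚ (ρ (S ∩ T))
      ∪,∩-tight = +-tight (proj₁ x∈P (S ∪ T) dS∪T) (proj₁ x∈P (S ∩ T) dS∩T) (begin
        ℕ→ℚ (ρ (S ∪ T)) + ℕ→ℚ (ρ (S ∩ T))      ≡⟨ ℕ→ℚ-+ (ρ (S ∪ T)) (ρ (S ∩ T)) ⟨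
        ℕ→ℚ (ρ (S ∪ T) ℕ.+ ρ (S ∩ T))         ≤⟨ ℕ→ℚ-mono-≤ (ρ-submod S T dS dT) ⟩
        ℕ→ℚ (ρ S ℕ.+ ρ T)                     ≡⟨ ℕ→ℚ-+ (ρ S) (ρ T) ⟩
        ℕ→ℚ (ρ S) + ℕ→ℚ (ρ T)                 ≡⟨ cong₂ _+_ S-tight T-tight ⟨
        sumOver S x + sumOver T x             ≡⟨ sumOver-∪-∩ S T x ⟨
        sumOver (S ∪ T) x + sumOver (S ∩ T) x ∎)

    -- Sets with no positive slack get the dummy value 1ℚ, which keeps the minimum ε positive.
    slack : Subset n → ℚ
    slack A with sumOver A x ℚ.<? ℕ→ℚ (ρ A)
    ... | yes _ = ℕ→ℚ (ρ A) - sumOver A x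
    ... | no  _ = 1ℚ

    slack-pos : ∀ A → 0ℚ ℚ.< slack A
    slack-pos A with sumOver A x ℚ.<? ℕ→ℚ (ρ A)
    ... | yes x<ρ = p<q⇒0<q-p x<ρ
    ... | no  _   = ℚ.positive⁻¹ 1ℚ

    slack-≤ : ∀ {A} → D A → sumOver A x ≢ ℕ→ℚ (ρ A) → sumOver A x + slack A ℚ.≤ ℕ→ℚ (ρ A)
    slack-≤ {A} dA x≢ρ with sumOver A x ℚ.<? ℕ→ℚ (ρ A)
    ... | yes _   = ℚ.≤-reflexive (a+[b-a]≡b (sumOver A x) (ℕ→ℚ (ρ A)))
      where
      a+[b-a]≡b : ∀ a b → a + (b - a) ≡ b
      a+[b-a]≡b = solve-∀ ℚ-ring
    ... | no  x≮ρ = contradiction (ℚ.≤-antisym (proj₁ x∈P A dA) (ℚ.≮⇒≥ x≮ρ)) x≢ρ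

    ε : ℚ
    ε = minOver n slack

    ε-pos : 0ℚ ℚ.< ε
    ε-pos = minOver-pos n slack slack-pos

    shift : Fin n → Fin n → Fin n → ℚ
    shift e f i = x i + ε * 𝟙 ⁅ e ⁆ i + (- ε) * 𝟙 ⁅ f ⁆ i

    sumOver-shift : ∀ A e f →
      sumOver A (shift e f) ≡ sumOver A x + ε * ℕ→ℚ ∣ A ∩ ⁅ e ⁆ ∣ + (- ε) * ℕ→ℚ ∣ A ∩ ⁅ f ⁆ ∣
    sumOver-shift A e f = begin
      sumOver A (shift e f)
        ≡⟨ sumOver-+ A _ _ ⟩
      sumOver A (λ i → x i + ε * 𝟙 ⁅ e ⁆ i) + sumOver A (λ i → (- ε) * 𝟙 ⁅ f ⁆ i)
        ≡⟨ cong₂ _+_ (sumOver-+ A x _) (sumOver-* A (- ε) (𝟙 ⁅ f ⁆)) ⟩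
      sumOver A x + sumOver A (λ i → ε * 𝟙 ⁅ e ⁆ i) + (- ε) * sumOver A (𝟙 ⁅ f ⁆)
        ≡⟨ cong (λ s → sumOver A x + s + (- ε) * sumOver A (𝟙 ⁅ f ⁆)) (sumOver-* A ε (𝟙 ⁅ e ⁆)) ⟩
      sumOver A x + ε * sumOver A (𝟙 ⁅ e ⁆) + (- ε) * sumOver A (𝟙 ⁅ f ⁆)
        ≡⟨ cong₂ (λ s t → sumOver A x + ε * s + (- ε) * t) (sumOver-𝟙 A ⁅ e ⁆) (sumOver-𝟙 A ⁅ f ⁆) ⟩
      sumOver A x + ε * ℕ→ℚ ∣ A ∩ ⁅ e ⁆ ∣ + (- ε) * ℕ→ℚ ∣ A ∩ ⁅ f ⁆ ∣
        ∎
      where open ≡-Reasoning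

    Tied : Fin n → Fin n → Set
    Tied e f = ∀ {S} → Tight x S → e ∈ S → f ∈ S

    shift∈P : ∀ {e f} → Tied e f → Tied f e → InBasePolyhedron n D ρ (shift e f)
    shift∈P {e} {f} e⇝f f⇝e = shift-≤ρ , trans (shift-tight tight-⊤) (proj₂ x∈P)
      where
      ∣A∩⁅e⁆∣≡∣A∩⁅f⁆∣ : ∀ {A} → Tight x A → ∣ A ∩ ⁅ e ⁆ ∣ ≡ ∣ A ∩ ⁅ f ⁆ ∣
      ∣A∩⁅e⁆∣≡∣A∩⁅f⁆∣ {A} tA with e ∈? A
      ... | yes e∈A = trans (cong ∣_∣ (x∈p⇒p∩⁅x⁆≡⁅x⁆ e∈A)) (trans (∣⁅x⁆∣≡1 e)
                        (sym (trans (cong ∣_∣ (x∈p⇒p∩⁅x⁆≡⁅x⁆ (e⇝f tA e∈A))) (∣⁅x⁆∣≡1 f))))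
      ... | no  e∉A = cong ∣_∣ (trans (x∉p⇒p∩⁅x⁆≡⊥ e∉A) (sym (x∉p⇒p∩⁅x⁆≡⊥ (e∉A ∘ f⇝e tA))))
      a+εk-εk≡a : ∀ a ε k → a + ε * k + (- ε) * k ≡ a
      a+εk-εk≡a = solve-∀ ℚ-ring
      shift-tight : ∀ {A} → Tight x A → sumOver A (shift e f) ≡ sumOver A x
      shift-tight {A} tA = begin
        sumOver A (shift e f)
          ≡⟨ sumOver-shift A e f ⟩
        sumOver A x + ε * ℕ→ℚ ∣ A ∩ ⁅ e ⁆ ∣ + (- ε) * ℕ→ℚ ∣ A ∩ ⁅ f ⁆ ∣
          ≡⟨ cong (λ k → sumOver A x + ε * ℕ→ℚ ∣ A ∩ ⁅ e ⁆ ∣ + (- ε) * ℕ→ℚ k) (∣A∩⁅e⁆∣≡∣A∩⁅f⁆∣ tA) ⟨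
        sumOver A x + ε * ℕ→ℚ ∣ A ∩ ⁅ e ⁆ ∣ + (- ε) * ℕ→ℚ ∣ A ∩ ⁅ e ⁆ ∣
          ≡⟨ a+εk-εk≡a (sumOver A x) ε (ℕ→ℚ ∣ A ∩ ⁅ e ⁆ ∣) ⟩
        sumOver A x
          ∎
        where open ≡-Reasoning
      shift-≤ρ : ∀ A → D A → sumOver A (shift e f) ℚ.≤ ℕ→ℚ (ρ A)
      shift-≤ρ A dA with sumOver A x ℚ.≟ ℕ→ℚ (ρ A)
      ... | yes x≡ρ = ℚ.≤-reflexive (trans (shift-tight (dA , x≡ρ)) x≡ρ)
      ... | no  x≢ρ = begin
        sumOver A (shift e f)
          ≡⟨ sumOver-shift A e f ⟩
        sumOver A x + ε * ℕ→ℚ ∣ A ∩ ⁅ e ⁆ ∣ + (- ε) * ℕ→ℚ ∣ A ∩ ⁅ f ⁆ ∣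
          ≤⟨ perturb-≤ (sumOver A x) ∣ A ∩ ⁅ e ⁆ ∣ ∣ A ∩ ⁅ f ⁆ ∣ (ℚ.<⇒≤ ε-pos) (∣p∩⁅x⁆∣≤1 A e) ⟩
        sumOver A x + ε
          ≤⟨ ℚ.+-monoʳ-≤ (sumOver A x) (minOver-≤ slack A) ⟩
        sumOver A x + slack A
          ≤⟨ slack-≤ dA x≢ρ ⟩
        ℕ→ℚ (ρ A)
          ∎
        where open ℚ.≤-Reasoning

    tied⇒≡ : ∀ {e f} → Tied e f → Tied f e → e ≡ f
    tied⇒≡ {e} {f} e⇝f f⇝e = decidable-stable (e Fin.≟ f) λ e≢f →
      ℚ.<-irrefl (sym (2ε≡0 e≢f)) (ℚ.+-mono-< ε-pos ε-pos)
      where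
      midpoint : ∀ a ε k m → a ≡ ½ * (a + ε * k + (- ε) * m) + (1ℚ - ½) * (a + ε * m + (- ε) * k)
      midpoint = solve-∀ ℚ-ring
      a+ε1-ε0≡a+ε : ∀ a ε → a + ε * 1ℚ + (- ε) * 0ℚ ≡ a + ε
      a+ε1-ε0≡a+ε = solve-∀ ℚ-ring
      a+ε0-ε1≡a-ε : ∀ a ε → a + ε * 0ℚ + (- ε) * 1ℚ ≡ a + - ε
      a+ε0-ε1≡a-ε = solve-∀ ℚ-ring
      shifts-agree : shift e f e ≡ shift f e e
      shifts-agree = proj₂ x-vertex (shift e f) (shift f e) ½ (shift∈P e⇝f f⇝e) (shift∈P f⇝e e⇝f)
        (ℚ.positive⁻¹ ½) (from-yes (½ ℚ.<? 1ℚ)) (λ i → midpoint (x i) ε (𝟙 ⁅ e ⁆ i) (𝟙 ⁅ f ⁆ i)) e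
      2ε≡0 : e ≢ f → ε + ε ≡ 0ℚ
      2ε≡0 e≢f = trans (cong (ε +_) ε≡-ε) (ℚ.+-inverseʳ ε)
        where
        open ≡-Reasoning
        𝟙⁅e⁆e≡1 : 𝟙 ⁅ e ⁆ e ≡ 1ℚ
        𝟙⁅e⁆e≡1 = 𝟙-∈ (x∈⁅x⁆ e)
        𝟙⁅f⁆e≡0 : 𝟙 ⁅ f ⁆ e ≡ 0ℚ
        𝟙⁅f⁆e≡0 = 𝟙-∉ (x≢y⇒x∉⁅y⁆ e≢f)
        ε≡-ε : ε ≡ - ε
        ε≡-ε = ∙-cancelˡ (x e) ε (- ε) (begin
          x e + ε                    ≡⟨ a+ε1-ε0≡a+ε (x e) ε ⟨
          x e + ε * 1ℚ + (- ε) * 0ℚ  ≡⟨ cong₂ (λ u v → x e + ε * u + (- ε) * v) 𝟙⁅e⁆e≡1 𝟙⁅f⁆e≡0 ⟨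
          shift e f e                ≡⟨ shifts-agree ⟩
          shift f e e                ≡⟨ cong₂ (λ u v → x e + ε * u + (- ε) * v) 𝟙⁅f⁆e≡0 𝟙⁅e⁆e≡1 ⟩
          x e + ε * 0ℚ + (- ε) * 1ℚ  ≡⟨ a+ε0-ε1≡a-ε (x e) ε ⟩
          x e + - ε                  ∎)

    minimal-tied : ∀ {T e f} → Tight x T → (∀ {S} → Tight x S × e ∈ S → ¬ S ⊂ T) →
                   e ∈ T → f ∈ T → Tied e f
    minimal-tied {T} {f = f} tT T-minimal e∈T f∈T {S} tS e∈S = decidable-stable (f ∈? S) λ f∉S →
      T-minimal (proj₂ (tight-∪-∩ tS tT) , x∈p∩q⁺ (e∈S , e∈T)) (p∩q⊆q S T , f , f∈T , f∉S ∘ p∩q⊆p S T)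

    maximal-tied : ∀ {T U e f} → Tight x T → Tight x U → e ∉ U →
                   (∀ {S} → Tight x S × S ⊆ T × e ∉ S → ¬ S ⊃ U) →
                   U ⊆ T → f ∈ T → f ∉ U → Tied f e
    maximal-tied {T} {U} {e} {f} tT tU e∉U U-maximal U⊆T f∈T f∉U {S} tS f∈S =
      decidable-stable (e ∈? S) λ e∉S →
        U-maximal (tV , V⊆T , [ e∉S ∘ p∩q⊆p S T , e∉U ]′ ∘ x∈p∪q⁻ (S ∩ T) U)
                  (q⊆p∪q (S ∩ T) U , f , p⊆p∪q U (x∈p∩q⁺ (f∈S , f∈T)) , f∉U)
      where
      tV : Tight x ((S ∩ T) ∪ U)
      tV = proj₁ (tight-∪-∩ (proj₂ (tight-∪-∩ tS tT)) tU)
      V⊆T : (S ∩ T) ∪ U ⊆ T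
      V⊆T = [ p∩q⊆q S T , U⊆T ]′ ∘ x∈p∪q⁻ (S ∩ T) U

    tight-∪⁅⁆⇒01 : ∀ {U e} → Tight x U → Tight x (U ∪ ⁅ e ⁆) → e ∉ U → x e ≡ 0ℚ ⊎ x e ≡ 1ℚ
    tight-∪⁅⁆⇒01 {U} {e} (dU , U-tight) (dU∪e , U∪e-tight) e∉U =
      Sum.map rank-same rank-jump (ρ[S∪⁅e⁆]≡ρS∨1+ρS dU dU∪e)
      where
      open ≡-Reasoning
      x[U]+xe≡ρ[U∪e] : sumOver U x + x e ≡ ℕ→ℚ (ρ (U ∪ ⁅ e ⁆))
      x[U]+xe≡ρ[U∪e] = trans (sym (sumOver-∪⁅⁆ x e∉U)) U∪e-tight
      rank-same : ρ (U ∪ ⁅ e ⁆) ≡ ρ U → x e ≡ 0ℚ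
      rank-same same = ∙-cancelˡ (sumOver U x) (x e) 0ℚ (begin
        sumOver U x + x e    ≡⟨ x[U]+xe≡ρ[U∪e] ⟩
        ℕ→ℚ (ρ (U ∪ ⁅ e ⁆))  ≡⟨ cong ℕ→ℚ same ⟩
        ℕ→ℚ (ρ U)            ≡⟨ U-tight ⟨
        sumOver U x          ≡⟨ ℚ.+-identityʳ _ ⟨
        sumOver U x + 0ℚ     ∎)
      rank-jump : ρ (U ∪ ⁅ e ⁆) ≡ ℕ.suc (ρ U) → x e ≡ 1ℚ
      rank-jump jump = ∙-cancelˡ (sumOver U x) (x e) 1ℚ (begin
        sumOver U x + x e    ≡⟨ x[U]+xe≡ρ[U∪e] ⟩
        ℕ→ℚ (ρ (U ∪ ⁅ e ⁆))  ≡⟨ cong ℕ→ℚ jump ⟩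
        ℕ→ℚ (ℕ.suc (ρ U))    ≡⟨ ℕ→ℚ-+ 1 (ρ U) ⟩
        1ℚ + ℕ→ℚ (ρ U)       ≡⟨ ℚ.+-comm 1ℚ (ℕ→ℚ (ρ U)) ⟩
        ℕ→ℚ (ρ U) + 1ℚ       ≡⟨ cong (_+ 1ℚ) U-tight ⟨
        sumOver U x + 1ℚ     ∎)

    vertex-01 : ∀ e → x e ≡ 0ℚ ⊎ x e ≡ 1ℚ
    vertex-01 e = decidable-stable (x e ℚ.≟ 0ℚ ⊎-dec x e ℚ.≟ 1ℚ) λ ¬01 →
      ¬¬-∃-minimal (λ T → Tight x T × e ∈ T) ⊂-wellFounded (tight-⊤ , ∈⊤)
        λ (T , (tT , e∈T) , T-minimal) →
      ¬¬-∃-minimal (λ U → Tight x U × U ⊆ T × e ∉ U) ⊃-wellFounded (tight-⊥ , ⊥⊆ , ∉⊥)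
        λ (U , (tU , U⊆T , e∉U) , U-maximal) →
      case ⊆⇒≡⊎⊂ (p⊆q∧x∈q⇒p∪⁅x⁆⊆q U⊆T e∈T) of λ
        { (inj₁ U∪e≡T) → ¬01 (tight-∪⁅⁆⇒01 tU (subst (Tight x) (sym U∪e≡T) tT) e∉U)
        ; (inj₂ (_ , f , f∈T , f∉U∪e)) →
            let f∉U = f∉U∪e ∘ p⊆p∪q ⁅ e ⁆
                e≡f = tied⇒≡ (minimal-tied tT T-minimal e∈T f∈T)
                             (maximal-tied tT tU e∉U U-maximal U⊆T f∈T f∉U)
            in f∉U∪e (subst (λ g → g ∈ U ∪ ⁅ e ⁆) e≡f (x∈p∪⁅x⁆ U))
        }

  basis-∩-≤ : ∀ {A B} → D A → IsBasis n D ρ B → ∣ A ∩ B ∣ ≤ ρ A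
  basis-∩-≤ {A} {B} dA (x , x-vertex , x-support) = ℕ→ℚ-cancel-≤ (begin
    ℕ→ℚ ∣ A ∩ B ∣    ≡⟨ sumOver-𝟙 A B ⟨
    sumOver A (𝟙 B)  ≡⟨ sumOver-cong A (01-vector≡𝟙 (Vertex.vertex-01 x-vertex) x-support) ⟨
    sumOver A x      ≤⟨ proj₁ (proj₁ x-vertex) A dA ⟩
    ℕ→ℚ (ρ A)        ∎)
    where open ℚ.≤-Reasoning

proposition3p6 : (n : ℕ) (D : Subset n → Set) (ρ : Subset n → ℕ) →
    IsUMatroid n D ρ → (A : Subset n) → D A →
    Σ (Subset n) (λ B → IsBasis n D ρ B × ∣ A ∩ B ∣ ≡ ρ A) ×
    ((B : Subset n) → IsBasis n D ρ B → ∣ A ∩ B ∣ ≤ ρ A)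
proposition3p6 n D ρ M A dA with UMatroid.chain-through M dA
... | c , A∈c = (greedy c , greedy-isBasis c , greedy-tight c A∈c) , λ _ → basis-∩-≤ dA
  where open UMatroid M
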